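{- Let $t$ be a binary tree with $\mathrm{Reg}(t) = r \geq 1$. Then the reduction $\Phi(t)$ is well-defined and $\mathrm{Reg}(\Phi(t)) = r - 1$.
   Context: A binary tree is either a leaf $\square$ or an inner node with an ordered pair of binary subtrees. The register function is defined recursively by $\mathrm{Reg}(\square)=0$ and, if $t$ has left and right subtrees $t_1,t_2$, $\mathrm{Reg}(t)=\max\{\mathrm{Reg}(t_1),\mathrm{Reg}(t_2)\}$ if $\mathrm{Reg}(t_1)\ne\mathrm{Reg}(t_2)$, and $\mathrm{Reg}(t)=\mathrm{Reg}(t_1)+1$ otherwise. The reduction $\Phi$ is the partial map on binary trees defined as follows: for $t\neq\square$, first erase all leaves of $t$; then, as long as there is a node with exactly one child, merge this node with its child; finally, the nodes without children become the leaves of the resulting binary tree $\Phi(t)$. $\Phi(\square)$ is undefined. -}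

module Defs where

open import Data.Nat using (ℕ; zero; suc; _⊔_; _≟_)
open import Data.Maybe using (Maybe; just; nothing)
open import Data.Bool using (if_then_else_)
open import Relation.Nullary using (does)

data Tree : Set where
  □    : Tree
  node : Tree → Tree → Tree

Reg : Tree → ℕ
Reg □ = 0
Reg (node t₁ t₂) =
  if does (Reg t₁ ≟ Reg t₂) then suc (Reg t₁) else (Reg t₁ ⊔ Reg t₂)

-- Trees obtained by erasing the leaves: every node has 0, 1 or 2 children.
data Pruned : Set where
  p0 : Pruned
  p1 : Pruned → Pruned
  p2 : Pruned → Pruned → Pruned

-- Step 1: erase all leaves (nothing = empty tree, which occurs only for □).
erase : Tree → Maybe Pruned
erase □ = nothing
erase (node t₁ t₂) with erase t₁ | erase t₂
... | nothing | nothing = just p0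
... | just x  | nothing = just (p1 x)
... | nothing | just y  = just (p1 y)
... | just x  | just y  = just (p2 x y)

contract : Pruned → Tree
contract p0       = □
contract (p1 x)   = contract x
contract (p2 x y) = node (contract x) (contract y)

Φ : Tree → Maybe Tree
Φ t with erase t
... | nothing = nothing
... | just x  = just (contract x)

module Submission where

-- By induction, every inner node t satisfies Reg t = 1 + Reg (Φ t). If both
-- children are inner, Φ keeps the node, and the register rule commutes with
-- adding one to both arguments. If one child is a leaf, Φ contracts the node,
-- and a leaf child (register 0) beside an inner child (register ≥ 1) does not
-- change the register either.

open import Defs
open import Data.Nat using (ℕ; suc; _≤_; _∸_; _⊔_; _≟_; _≡ᵇ_)
open import Data.Maybe using (just)
open import Data.Bool using (if_then_else_; true; false)
open import Data.Product using (Σ; _×_; _,_)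
open import Relation.Binary.PropositionalEquality using (_≡_; refl; cong; sym; trans)
open import Relation.Nullary using (does)

-- The body of Reg: Reg (node a b) reduces to joinReg (Reg a) (Reg b).
joinReg : ℕ → ℕ → ℕ
joinReg m n = if does (m ≟ n) then suc m else m ⊔ n

joinReg-suc : ∀ m n → joinReg (suc m) (suc n) ≡ suc (joinReg m n)
joinReg-suc m n with m ≡ᵇ n
... | true  = refl
... | false = refl

erase≡just⇒Φ≡just : ∀ t {x} → erase t ≡ just x → Φ t ≡ just (contract x)
erase≡just⇒Φ≡just _ eq rewrite eq = refl

erase-node : ∀ a b → Σ Pruned λ x →
  (erase (node a b) ≡ just x) × (Reg (node a b) ≡ suc (Reg (contract x)))
erase-node □ □ = p0 , refl , refl
erase-node (node a b) □ with erase-node a b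
... | x , erase≡ , reg≡ rewrite erase≡ =
  p1 x , refl , cong (λ r → joinReg r 0) reg≡
erase-node □ (node c d) with erase-node c d
... | y , erase≡ , reg≡ rewrite erase≡ =
  p1 y , refl , cong (joinReg 0) reg≡
erase-node (node a b) (node c d) with erase-node a b | erase-node c d
... | x , eraseˡ≡ , regˡ≡ | y , eraseʳ≡ , regʳ≡
  rewrite eraseˡ≡ | eraseʳ≡ | regˡ≡ | regʳ≡ =
  p2 x y , refl , joinReg-suc (Reg (contract x)) (Reg (contract y))

proposition2p2 : (t : Tree) (r : ℕ) → Reg t ≡ r → 1 ≤ r →
    Σ Tree (λ s → (Φ t ≡ just s) × (Reg s ≡ r ∸ 1))
proposition2p2 □ .0 refl ()
proposition2p2 (node a b) r Reg≡r _ with erase-node a b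
... | x , erase≡ , reg≡ =
  contract x , erase≡just⇒Φ≡just (node a b) erase≡ , cong (_∸ 1) (trans (sym reg≡) Reg≡r)
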